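{- Let $R=\langle 1,1,2,3,4,\ldots\rangle$, i.e. $s=1$ and $r_i=i$ for all $i\ge 1$, and let $a$ be the associated function as in the context. Let $F_n$ denote the Fibonacci numbers with $F_0=0$, $F_1=1$, $F_{n+1}=F_n+F_{n-1}$. Then for all $n\ge 1$, $a(F_{2n})=F_{2n-2}$.
   Context: For a sequence $R=\langle s,r_1,r_2,\ldots\rangle$ of nonnegative integers with $s\ge 1$: let $\Sigma=\{\mathtt r,\mathtt 0,\mathtt 1,\mathtt 2,\ldots\}$ be the infinite alphabet consisting of a letter $\mathtt r$ together with a letter $[j]$ for each integer $j\ge 0$; for a letter $\mathtt x$ and $m\ge0$, $\mathtt x^m$ is the word of $m$ copies of $\mathtt x$; let $\sigma$ be the morphism of words over $\Sigma$ defined by $\sigma(\mathtt r)=\mathtt r\,\mathtt 0^{s}$ and $\sigma([j])=[j+1]\,\mathtt 0^{r_{j+1}}$ for $j\ge 0$. Let $\mathcal T$ be the infinite rooted ordered tree whose root is labelled $\mathtt r$ and in which the labels of the children of any node labelled $\mathtt x$, read left to right, spell $\sigma(\mathtt x)$. For a node $v$, $\ell(v)$ is the number of nodes in the same row (depth) as $v$ lying strictly to its left. Define $a:\mathbb Z\to\mathbb Z_{\ge0}$ by $a(n)=0$ for $n<0$ and $a(\ell(v))=\ell(\mathrm{parent}(v))$ for every non-root node $v$ of $\mathcal T$ (this is well defined). -}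

module Defs where

open import Data.Nat using (ℕ; zero; suc; _+_; _<_)
open import Data.List using (List; []; _∷_; _++_; length; concatMap; replicate)

data Letter : Set where
  rL  : Letter
  num : ℕ → Letter

-- The morphism σ for R = ⟨s, r₁, r₂, …⟩ (the sequence r is given as a
-- function ℕ → ℕ; only its values at indices ≥ 1 are used).
σ : (s : ℕ) → (r : ℕ → ℕ) → Letter → List Letter
σ s r rL      = rL ∷ replicate s (num 0)
σ s r (num j) = num (suc j) ∷ replicate (r (suc j)) (num 0)

-- Row k of the tree 𝒯 (labels of the nodes at depth k, left to right).
row : (s : ℕ) → (r : ℕ → ℕ) → ℕ → List Letter
row s r zero    = rL ∷ []
row s r (suc k) = concatMap (σ s r) (row s r k)

-- ChildOf s r xs i p : in the row obtained by expanding xs (children read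
-- left to right), the node at position i (number of nodes strictly to its
-- left) is a child of the node at position p of xs.
data ChildOf (s : ℕ) (r : ℕ → ℕ) : List Letter → ℕ → ℕ → Set where
  here  : ∀ {x xs i} → i < length (σ s r x) → ChildOf s r (x ∷ xs) i 0
  there : ∀ {x xs i p} → ChildOf s r xs i p →
          ChildOf s r (x ∷ xs) (length (σ s r x) + i) (suc p)

-- ParentPos s r k i p : the node v at depth k+1 with ℓ(v) = i exists and
-- its parent (at depth k) has ℓ(parent v) = p.  Thus a(i) = p.
ParentPos : (s : ℕ) → (r : ℕ → ℕ) → ℕ → ℕ → ℕ → Set
ParentPos s r k i p = ChildOf s r (row s r k) i p

fib : ℕ → ℕ
fib zero          = 0
fib (suc zero)    = 1
fib (suc (suc n)) = fib (suc n) + fib n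

-- Rows of the tree grow by extension (row k is a prefix of row k+1,
-- as σ(r) begins with r), so the position of the parent of the node at position i
-- does not depend on the row, and it suffices to exhibit one such node. For
-- R = ⟨1,1,2,3,…⟩, row m+1 reads  r ns 0 …  where the labels ns of the block
-- satisfy 1 + |ns| = F₂ₘ₊₂ and 1 + Σ ns = F₂ₘ₊₁: applying σ to  r ns 0  yields
-- r (0 σ(ns) 1) 0 …, whose block obeys the same equations two Fibonacci indices
-- further on. The final 0 of σ(0) = 1 0 sits at position F₂ₘ₊₄ and its parent 0
-- at position F₂ₘ₊₂.
module Submission where

open import Defs
open import Data.Nat using (ℕ; _*_; _∸_; _≤_)
open import Data.Product using (_×_; ∃)
open import Relation.Binary.PropositionalEquality using (_≡_)

open import Data.Nat using (zero; suc; _+_; _<_; z≤n; s≤s)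
open import Data.Nat.Properties using (+-cancelˡ-≡; m≤m+n; +-comm; +-assoc; +-identityʳ; +-suc; *-suc; <⇒≱)
open import Data.Nat.Tactic.RingSolver using (solve-∀)
open import Data.List using (List; []; _∷_; _++_; length; concatMap; replicate; map)
open import Data.Nat.ListAction using (sum)
open import Data.Nat.ListAction.Properties using (sum-++)
open import Data.List.Properties
  using (length-++; length-map; length-replicate; map-++; map-replicate; ++-assoc;
         concatMap-++; concatMap-map; concatMap-cong; map-concatMap)
open import Data.Product using (_,_; proj₁)
open import Data.Empty using (⊥-elim)
open import Relation.Binary.PropositionalEquality
  using (refl; sym; trans; cong; cong₂; subst; subst₂; module ≡-Reasoning)

module _ {s : ℕ} {r : ℕ → ℕ} where

  ChildOf-functional : ∀ {xs i j p q} → ChildOf s r xs i p → ChildOf s r xs j q → i ≡ j → p ≡ q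
  ChildOf-functional (here _) (here _) _ = refl
  ChildOf-functional (here {x = x} i<∣σx∣) (there {i = j} _) refl =
    ⊥-elim (<⇒≱ i<∣σx∣ (m≤m+n (length (σ s r x)) j))
  ChildOf-functional (there {x = x} {i = i} _) (here j<∣σx∣) refl =
    ⊥-elim (<⇒≱ j<∣σx∣ (m≤m+n (length (σ s r x)) i))
  ChildOf-functional (there {x = x} c) (there c′) eq =
    cong suc (ChildOf-functional c c′ (+-cancelˡ-≡ (length (σ s r x)) _ _ eq))

  ChildOf-++ʳ : ∀ {xs i p} ys → ChildOf s r xs i p → ChildOf s r (xs ++ ys) i p
  ChildOf-++ʳ ys (here i<∣σx∣) = here i<∣σx∣
  ChildOf-++ʳ ys (there c)     = there (ChildOf-++ʳ ys c)

  ChildOf-++-∷ : ∀ xs {x ys i} → i < length (σ s r x) →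
                 ChildOf s r (xs ++ x ∷ ys) (length (concatMap (σ s r) xs) + i) (length xs)
  ChildOf-++-∷ []        i<∣σx∣ = here i<∣σx∣
  ChildOf-++-∷ (x′ ∷ xs) {x} {ys} {i} i<∣σx∣ =
    subst (λ j → ChildOf s r (x′ ∷ xs ++ x ∷ ys) j (suc (length xs)))
          (trans (sym (+-assoc (length (σ s r x′)) _ i)) (cong (_+ i) (sym (length-++ (σ s r x′)))))
          (there (ChildOf-++-∷ xs i<∣σx∣))

  row-suc-extends : ∀ k → ∃ λ ys → row s r (suc k) ≡ row s r k ++ ys
  row-suc-extends zero    = replicate s (num 0) ++ [] , refl
  row-suc-extends (suc k) with row-suc-extends k
  ... | ys , eq = concatMap (σ s r) ys , trans (cong (concatMap (σ s r)) eq) (concatMap-++ (σ s r) (row s r k) ys)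

  ParentPos-+ : ∀ k m {i p} → ParentPos s r k i p → ParentPos s r (k + m) i p
  ParentPos-+ k zero    c rewrite +-identityʳ k = c
  ParentPos-+ k (suc m) c with row-suc-extends (k + m)
  ... | ys , eq rewrite +-suc k m | eq = ChildOf-++ʳ ys (ParentPos-+ k m c)

  -- This is the well-definedness of the function a.
  ParentPos-functional : ∀ k k′ {i p q} → ParentPos s r k i p → ParentPos s r k′ i q → p ≡ q
  ParentPos-functional k k′ {i} {q = q} c c′ =
    ChildOf-functional (ParentPos-+ k k′ c)
      (subst (λ t → ParentPos s r t i q) (+-comm k′ k) (ParentPos-+ k′ k c′)) refl

  HasParentPos : ℕ → ℕ → Set
  HasParentPos i p = ∃ (λ k → ParentPos s r k i p) × ((k q : ℕ) → ParentPos s r k i q → q ≡ p)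

  ParentPos⇒HasParentPos : ∀ k {i p} → ParentPos s r k i p → HasParentPos i p
  ParentPos⇒HasParentPos k c = (k , c) , λ k′ q c′ → ParentPos-functional k′ k c′ c

σ₁ : Letter → List Letter
σ₁ = σ 1 (λ i → i)

row₁ : ℕ → List Letter
row₁ = row 1 (λ i → i)

children : ℕ → List ℕ
children j = suc j ∷ replicate (suc j) 0

expand : List ℕ → List ℕ
expand = concatMap children

concatMap-σ₁-num : ∀ ns → concatMap σ₁ (map num ns) ≡ map num (expand ns)
concatMap-σ₁-num ns = begin
  concatMap σ₁ (map num ns)              ≡⟨ concatMap-map σ₁ num ns ⟩
  concatMap (λ j → σ₁ (num j)) ns        ≡⟨ concatMap-cong σ₁-num ns ⟩
  concatMap (λ j → map num (children j)) ns ≡⟨ map-concatMap num children ns ⟨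
  map num (expand ns)                    ∎
  where
  open ≡-Reasoning
  σ₁-num : ∀ j → σ₁ (num j) ≡ map num (children j)
  σ₁-num j = cong (num (suc j) ∷_) (sym (map-replicate num (suc j) 0))

sum-replicate-zero : ∀ n → sum (replicate n 0) ≡ 0
sum-replicate-zero zero    = refl
sum-replicate-zero (suc n) = sum-replicate-zero n

length-expand : ∀ ns → length (expand ns) ≡ 2 * length ns + sum ns
length-expand []       = refl
length-expand (j ∷ js) = begin
  length (children j ++ expand js)
    ≡⟨ length-++ (children j) ⟩
  suc (length (replicate (suc j) 0) + length (expand js))
    ≡⟨ cong₂ (λ a b → suc (a + b)) (length-replicate (suc j)) (length-expand js) ⟩
  suc (suc j + (2 * length js + sum js))
    ≡⟨ rearrange j (length js) (sum js) ⟩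
  2 * suc (length js) + (j + sum js) ∎
  where
  open ≡-Reasoning
  rearrange : ∀ a b c → suc (suc a + (2 * b + c)) ≡ 2 * suc b + (a + c)
  rearrange = solve-∀

sum-expand : ∀ ns → sum (expand ns) ≡ sum ns + length ns
sum-expand []       = refl
sum-expand (j ∷ js) = begin
  suc j + sum (replicate (suc j) 0 ++ expand js)
    ≡⟨ cong (suc j +_) (sum-++ (replicate (suc j) 0) (expand js)) ⟩
  suc j + (sum (replicate (suc j) 0) + sum (expand js))
    ≡⟨ cong₂ (λ a b → suc j + (a + b)) (sum-replicate-zero (suc j)) (sum-expand js) ⟩
  suc j + (sum js + length js)
    ≡⟨ rearrange j (sum js) (length js) ⟩
  j + sum js + suc (length js) ∎
  where
  open ≡-Reasoning
  rearrange : ∀ a b c → suc a + (b + c) ≡ a + b + suc c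
  rearrange = solve-∀

block : List ℕ → List Letter
block ns = rL ∷ map num ns

next : List ℕ → List ℕ
next ns = 0 ∷ expand ns ++ 1 ∷ []

labels : ℕ → List ℕ
labels zero    = []
labels (suc m) = next (labels m)

concatMap-σ₁-block : ∀ ns → concatMap σ₁ (block ns) ++ num 1 ∷ [] ≡ block (next ns)
concatMap-σ₁-block ns = cong (λ t → rL ∷ num 0 ∷ t) (begin
  concatMap σ₁ (map num ns) ++ num 1 ∷ [] ≡⟨ cong (_++ num 1 ∷ []) (concatMap-σ₁-num ns) ⟩
  map num (expand ns) ++ map num (1 ∷ []) ≡⟨ map-++ num (expand ns) (1 ∷ []) ⟨
  map num (expand ns ++ 1 ∷ [])           ∎)
  where open ≡-Reasoning

row₁-shape : ∀ m → ∃ λ ys → row₁ (suc m) ≡ block (labels m) ++ num 0 ∷ ys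
row₁-shape zero    = [] , refl
row₁-shape (suc m) with row₁-shape m
... | ys , eq = concatMap σ₁ ys , (begin
  concatMap σ₁ (row₁ (suc m))
    ≡⟨ cong (concatMap σ₁) eq ⟩
  concatMap σ₁ (block ns ++ num 0 ∷ ys)
    ≡⟨ concatMap-++ σ₁ (block ns) (num 0 ∷ ys) ⟩
  concatMap σ₁ (block ns) ++ num 1 ∷ num 0 ∷ concatMap σ₁ ys
    ≡⟨ ++-assoc (concatMap σ₁ (block ns)) (num 1 ∷ []) _ ⟨
  (concatMap σ₁ (block ns) ++ num 1 ∷ []) ++ num 0 ∷ concatMap σ₁ ys
    ≡⟨ cong (_++ num 0 ∷ concatMap σ₁ ys) (concatMap-σ₁-block ns) ⟩
  block (next ns) ++ num 0 ∷ concatMap σ₁ ys ∎)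
  where
  ns = labels m
  open ≡-Reasoning

length-next : ∀ ns → suc (length (next ns)) ≡ (suc (length ns) + suc (sum ns)) + suc (length ns)
length-next ns = begin
  suc (suc (length (expand ns ++ 1 ∷ [])))   ≡⟨ cong (λ t → suc (suc t)) (length-++ (expand ns)) ⟩
  suc (suc (length (expand ns) + 1))         ≡⟨ cong (λ t → suc (suc (t + 1))) (length-expand ns) ⟩
  suc (suc (2 * length ns + sum ns + 1))     ≡⟨ rearrange (length ns) (sum ns) ⟩
  (suc (length ns) + suc (sum ns)) + suc (length ns) ∎
  where
  open ≡-Reasoning
  rearrange : ∀ a b → suc (suc (2 * a + b + 1)) ≡ (suc a + suc b) + suc a
  rearrange = solve-∀

sum-next : ∀ ns → suc (sum (next ns)) ≡ suc (length ns) + suc (sum ns)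
sum-next ns = begin
  suc (sum (expand ns ++ 1 ∷ []))  ≡⟨ cong suc (sum-++ (expand ns) (1 ∷ [])) ⟩
  suc (sum (expand ns) + 1)        ≡⟨ cong (λ t → suc (t + 1)) (sum-expand ns) ⟩
  suc (sum ns + length ns + 1)     ≡⟨ rearrange (length ns) (sum ns) ⟩
  suc (length ns) + suc (sum ns)   ∎
  where
  open ≡-Reasoning
  rearrange : ∀ a b → suc (b + a + 1) ≡ suc a + suc b
  rearrange = solve-∀

next-fib : ∀ e ns → suc (length ns) ≡ fib (2 + e) → suc (sum ns) ≡ fib (1 + e) →
           suc (length (next ns)) ≡ fib (4 + e) × suc (sum (next ns)) ≡ fib (3 + e)
next-fib e ns length≡ sum≡ =
  trans (length-next ns) (cong₂ (λ a b → (a + b) + a) length≡ sum≡) ,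
  trans (sum-next ns) (cong₂ _+_ length≡ sum≡)

labels-fib : ∀ m → suc (length (labels m)) ≡ fib (2 + 2 * m) × suc (sum (labels m)) ≡ fib (1 + 2 * m)
labels-fib zero = refl , refl
labels-fib (suc m) with labels-fib m
... | length≡ , sum≡ =
  subst (λ e → suc (length (labels (suc m))) ≡ fib (2 + e) × suc (sum (labels (suc m))) ≡ fib (1 + e))
        (sym (*-suc 2 m))
        (next-fib (2 * m) (labels m) length≡ sum≡)

length-block : ∀ ns → length (block ns) ≡ suc (length ns)
length-block ns = cong suc (length-map num ns)

parentPos-block : ∀ m → ParentPos 1 (λ i → i) (suc m) (length (block (labels (suc m)))) (length (block (labels m)))
parentPos-block m with row₁-shape m
... | ys , eq rewrite eq =
  subst (λ i → ChildOf 1 (λ i → i) (block ns ++ num 0 ∷ ys) i (length (block ns)))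
        (begin
          length (concatMap σ₁ (block ns)) + 1           ≡⟨ length-++ (concatMap σ₁ (block ns)) ⟨
          length (concatMap σ₁ (block ns) ++ num 1 ∷ []) ≡⟨ cong length (concatMap-σ₁-block ns) ⟩
          length (block (next ns))                       ∎)
        (ChildOf-++-∷ (block ns) (s≤s (s≤s z≤n)))
  where
  ns = labels m
  open ≡-Reasoning

parentPos-fib : ∀ k → ParentPos 1 (λ i → i) k (fib (2 + 2 * k)) (fib (2 * k))
parentPos-fib zero    = here (s≤s (s≤s z≤n))
parentPos-fib (suc m) =
  subst₂ (ParentPos 1 (λ i → i) (suc m))
         (trans (length-block (labels (suc m))) (proj₁ (labels-fib (suc m))))
         (trans (length-block (labels m)) (trans (proj₁ (labels-fib m)) (cong fib (sym (*-suc 2 m)))))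
         (parentPos-block m)

proposition10 : (n : ℕ) → 1 ≤ n →
    ∃ (λ k → ParentPos 1 (λ i → i) k (fib (2 * n)) (fib (2 * n ∸ 2)))
    × ((k p : ℕ) → ParentPos 1 (λ i → i) k (fib (2 * n)) p → p ≡ fib (2 * n ∸ 2))
proposition10 (suc k) _ =
  subst₂ HasParentPos (cong fib (sym (*-suc 2 k))) (cong (λ e → fib (e ∸ 2)) (sym (*-suc 2 k)))
         (ParentPos⇒HasParentPos k (parentPos-fib k))
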